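{- For every first-order structure $M$, the algebraic power set of $M$ equals the implicitly definable power set of $M$: $P_{\rm alg}(M)=P_{\rm imp}(M)$.
   Context: Let $M$ be a first-order structure. A class $A\subseteq M$ is implicitly definable over $M$ if there is a first-order formula $\psi(A)$ in the language of $M$ expanded by a new predicate symbol for $A$, with parameters from $M$, such that $A$ is the unique $B\subseteq M$ with $\langle M,B\rangle\models\psi(B)$. A class $A\subseteq M$ is algebraic over $M$ if there is such a formula $\psi$ (with parameters from $M$) such that $\langle M,A\rangle\models\psi(A)$ and there are only finitely many $B\subseteq M$ with $\langle M,B\rangle\models\psi(B)$. $P_{\rm imp}(M)$ is the set of all $A\subseteq M$ implicitly definable over $M$, and $P_{\rm alg}(M)$ is the set of all $A\subseteq M$ algebraic over $M$. -}

module Defs where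

open import Data.Nat using (ℕ; suc)
open import Data.Fin using (Fin; zero; suc)
open import Data.Empty using (⊥)
open import Data.Unit using (⊤)
open import Data.Product using (Σ; _×_; ∃; _,_)
open import Data.Sum using (_⊎_)
open import Data.List using (List)
open import Data.List.Relation.Unary.Any using (Any)
open import Relation.Binary.PropositionalEquality using (_≡_)
open import Function.Bundles using (_⇔_)

record Language : Set₁ where
  field
    Func : ℕ → Set          -- function symbols of each arity (constants = arity 0)
    Rel  : ℕ → Set

record Structure (L : Language) : Set₁ where
  open Language L
  field
    Carrier : Set
    funᴹ    : ∀ {k} → Func k → (Fin k → Carrier) → Carrier
    relᴹ    : ∀ {k} → Rel k → (Fin k → Carrier) → Set

module _ {L : Language} (M : Structure L) where
  open Language L
  open Structure M

  data Term (n : ℕ) : Set where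
    var : Fin n → Term n
    par : Carrier → Term n
    app : ∀ {k} → Func k → (Fin k → Term n) → Term n

  -- Formulas of L expanded by one new unary predicate symbol X,
  -- with parameters from M and n free variables.
  data Formula (n : ℕ) : Set where
    ⊥ᶠ  : Formula n
    _≐ᶠ_ : Term n → Term n → Formula n
    rel : ∀ {k} → Rel k → (Fin k → Term n) → Formula n
    X   : Term n → Formula n
    ¬ᶠ_ : Formula n → Formula n
    _∧ᶠ_ _∨ᶠ_ _⇒ᶠ_ : Formula n → Formula n → Formula n
    ∀ᶠ ∃ᶠ : Formula (suc n) → Formula n

  Class : Set₁
  Class = Carrier → Set

  _≗ᶜ_ : Class → Class → Set
  A ≗ᶜ B = ∀ x → A x ⇔ B x

  _∷ᵉ_ : ∀ {n} → Carrier → (Fin n → Carrier) → Fin (suc n) → Carrier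
  (a ∷ᵉ ρ) zero    = a
  (a ∷ᵉ ρ) (suc i) = ρ i

  ⟦_⟧ₜ : ∀ {n} → Term n → (Fin n → Carrier) → Carrier
  ⟦ var i ⟧ₜ ρ    = ρ i
  ⟦ par m ⟧ₜ ρ    = m
  ⟦ app f ts ⟧ₜ ρ = funᴹ f (λ i → ⟦ ts i ⟧ₜ ρ)

  Sat : ∀ {n} → Class → (Fin n → Carrier) → Formula n → Set
  Sat B ρ ⊥ᶠ         = ⊥
  Sat B ρ (s ≐ᶠ t)   = ⟦ s ⟧ₜ ρ ≡ ⟦ t ⟧ₜ ρ
  Sat B ρ (rel r ts) = relᴹ r (λ i → ⟦ ts i ⟧ₜ ρ)
  Sat B ρ (X t)      = B (⟦ t ⟧ₜ ρ)
  Sat B ρ (¬ᶠ φ)     = Sat B ρ φ → ⊥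
  Sat B ρ (φ ∧ᶠ ψ)   = Sat B ρ φ × Sat B ρ ψ
  Sat B ρ (φ ∨ᶠ ψ)   = Sat B ρ φ ⊎ Sat B ρ ψ
  Sat B ρ (φ ⇒ᶠ ψ)   = Sat B ρ φ → Sat B ρ ψ
  Sat B ρ (∀ᶠ φ)     = ∀ a → Sat B (a ∷ᵉ ρ) φ
  Sat B ρ (∃ᶠ φ)     = ∃ λ a → Sat B (a ∷ᵉ ρ) φ

  noVars : Fin 0 → Carrier
  noVars ()

  _⊨_ : Class → Formula 0 → Set
  B ⊨ ψ = Sat B noVars ψ

  ImplicitlyDefinable : Class → Set₁
  ImplicitlyDefinable A =
    Σ (Formula 0) λ ψ → (A ⊨ ψ) × (∀ (B : Class) → B ⊨ ψ → B ≗ᶜ A)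

  -- A is algebraic over M: A satisfies ψ, and only finitely many classes do
  -- (every class satisfying ψ is extensionally equal to one in a finite list)
  Algebraic : Class → Set₁
  Algebraic A =
    Σ (Formula 0) λ ψ → (A ⊨ ψ) ×
      Σ (List Class) λ Bs → ∀ (B : Class) → B ⊨ ψ → Any (λ C → B ≗ᶜ C) Bs

module Submission where

open import Defs
open import Level using (0ℓ)
open import Axiom.ExcludedMiddle using (ExcludedMiddle)
open import Function.Bundles using (_⇔_; mk⇔)
open import Function.Construct.Composition using (_⇔-∘_)
open import Function.Construct.Symmetry using (⇔-sym)
open import Data.Product using (∃; _,_)
open import Data.Empty using (⊥-elim)
open import Data.List using (List; []; _∷_; foldr)
open import Data.List.Relation.Unary.Any using (Any; here; there)
open import Relation.Nullary using (yes; no; ¬_)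

-- An implicit definition is an algebraic one with a single candidate. Conversely, if ψ has
-- only the candidates C₁, …, Cₙ, then for each Cᵢ ≠ A pick a point x where Cᵢ and A
-- differ and conjoin to ψ the literal X(x) or ¬X(x) that A satisfies; the resulting
-- sentence still holds of A and rules out every Cᵢ ≠ A, so A is its unique model.

implicitlyDefinable⇒algebraic : {L : Language} (M : Structure L) (A : Class M) →
  ImplicitlyDefinable M A → Algebraic M A
implicitlyDefinable⇒algebraic M A (ψ , A⊨ψ , unique) =
  ψ , A⊨ψ , A ∷ [] , λ B B⊨ψ → here (unique B B⊨ψ)

module _ (em : ExcludedMiddle 0ℓ) {L : Language} (M : Structure L) where
  open Structure M

  membershipLiteral : Class M → Carrier → Formula M 0
  membershipLiteral A x with em {A x}
  ... | yes _ = X (par x)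
  ... | no _  = ¬ᶠ X (par x)

  membershipLiteral-holds : ∀ A x → _⊨_ M A (membershipLiteral A x)
  membershipLiteral-holds A x with em {A x}
  ... | yes x∈A = x∈A
  ... | no x∉A  = x∉A

  membershipLiteral-agrees : ∀ {A B} x → _⊨_ M B (membershipLiteral A x) → B x ⇔ A x
  membershipLiteral-agrees {A} x B⊨lit with em {A x}
  ... | yes x∈A = mk⇔ (λ _ → x∈A) (λ _ → B⊨lit)
  ... | no x∉A  = mk⇔ (λ x∈B → ⊥-elim (B⊨lit x∈B)) (λ x∈A → ⊥-elim (x∉A x∈A))

  separator : Class M → Class M → Formula M 0
  separator A C with em {∃ λ x → ¬ (C x ⇔ A x)}
  ... | yes (x , _) = membershipLiteral A x
  ... | no _        = ¬ᶠ ⊥ᶠ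

  separator-holds : ∀ A C → _⊨_ M A (separator A C)
  separator-holds A C with em {∃ λ x → ¬ (C x ⇔ A x)}
  ... | yes (x , _) = membershipLiteral-holds A x
  ... | no _        = λ ()

  separator-forces : ∀ {A B C} → _≗ᶜ_ M B C → _⊨_ M B (separator A C) → _≗ᶜ_ M B A
  separator-forces {A} {B} {C} B≗C B⊨sep with em {∃ λ x → ¬ (C x ⇔ A x)}
  ... | yes (x , C≠A) = ⊥-elim (C≠A (membershipLiteral-agrees x B⊨sep ⇔-∘ ⇔-sym (B≗C x)))
  ... | no C≗A = λ y → C≗A-at y ⇔-∘ B≗C y
    where
    C≗A-at : ∀ y → C y ⇔ A y
    C≗A-at y with em {C y ⇔ A y}
    ... | yes Cy⇔Ay = Cy⇔Ay
    ... | no Cy≠Ay  = ⊥-elim (C≗A (y , Cy≠Ay))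

  withSeparators : Class M → Formula M 0 → List (Class M) → Formula M 0
  withSeparators A = foldr (λ C φ → φ ∧ᶠ separator A C)

  withSeparators-holds : ∀ A ψ → _⊨_ M A ψ → ∀ Cs → _⊨_ M A (withSeparators A ψ Cs)
  withSeparators-holds A ψ A⊨ψ []       = A⊨ψ
  withSeparators-holds A ψ A⊨ψ (C ∷ Cs) = withSeparators-holds A ψ A⊨ψ Cs , separator-holds A C

  withSeparators-weakens : ∀ A B ψ Cs → _⊨_ M B (withSeparators A ψ Cs) → _⊨_ M B ψ
  withSeparators-weakens A B ψ []       B⊨ψ       = B⊨ψ
  withSeparators-weakens A B ψ (C ∷ Cs) (B⊨φ , _) = withSeparators-weakens A B ψ Cs B⊨φ

  withSeparators-forces : ∀ {A B} ψ Cs → _⊨_ M B (withSeparators A ψ Cs) →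
    Any (_≗ᶜ_ M B) Cs → _≗ᶜ_ M B A
  withSeparators-forces ψ (C ∷ Cs) (_ , B⊨sep) (here B≗C) = separator-forces B≗C B⊨sep
  withSeparators-forces ψ (C ∷ Cs) (B⊨φ , _)   (there p)  = withSeparators-forces ψ Cs B⊨φ p

  algebraic⇒implicitlyDefinable : ∀ A → Algebraic M A → ImplicitlyDefinable M A
  algebraic⇒implicitlyDefinable A (ψ , A⊨ψ , Cs , finite) =
    withSeparators A ψ Cs , withSeparators-holds A ψ A⊨ψ Cs ,
    λ B B⊨ψ′ → withSeparators-forces ψ Cs B⊨ψ′ (finite B (withSeparators-weakens A B ψ Cs B⊨ψ′))

mainTheorem5 : ExcludedMiddle 0ℓ → (L : Language) (M : Structure L) (A : Class M) →
    Algebraic M A ⇔ ImplicitlyDefinable M A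
mainTheorem5 em L M A =
  mk⇔ (algebraic⇒implicitlyDefinable em M A) (implicitlyDefinable⇒algebraic M A)
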